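{- Let $r\ge1$ be an integer, $k_1,\dots,k_r$ integers, $a$ a complex number that is not an integer $\le r-1$, and $x$ a variable. Then for every integer $n\ge0$, $$B^{(k_1,\dots,k_r)}_{n,a}(x)=\sum_{0\le m_1\le m_2\le\dots\le m_r\le n}\frac{m_r!\,\left\{ n \atop m_r\right\}_{ -1,\,xr}}{(m_1+a-r+1)^{k_1}(m_2+a-r+2)^{k_2}\cdots(m_r+a)^{k_r}}.$$
   Context: The generalized Hurwitz–Lerch multiple zeta function is the formal power series in $z$ $$\Phi_{(k_1,\dots,k_r)}(z,a)=\sum_{0\le m_1\le m_2\le\dots\le m_r}\frac{z^{m_r}}{(m_1+a-r+1)^{k_1}(m_2+a-r+2)^{k_2}\cdots(m_r+a)^{k_r}}$$ (the condition on $a$ ensures no denominator vanishes). The Hurwitz–Lerch type multi poly-Bernoulli polynomials are defined by $$\Phi_{(k_1,\dots,k_r)}(1-e^{ -t},a)\,e^{rxt}=\sum_{n=0}^\infty B^{(k_1,\dots,k_r)}_{n,a}(x)\frac{t^n}{n!}.$$ For a number $\beta\ne0$ and a parameter $\rho$, the $(\rho,\beta)$-Stirling numbers $\left\{ n \atop m\right\}_{\beta,\rho}$ are defined by $\frac{1}{\beta^m m!}e^{\rho t}(e^{\beta t}-1)^m=\sum_{n=0}^\infty\left\{ n \atop m\right\}_{\beta,\rho}\frac{t^n}{n!}$; in the claim $\beta=-1$ and $\rho=xr$. -}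

module Defs where

open import Level using (Level; _⊔_) renaming (suc to lsuc)
open import Algebra.Bundles using (CommutativeRing)
open import Data.Nat as ℕ using (ℕ; zero; suc; _∸_)
open import Data.Nat.Combinatorics using (_C_)
open import Data.Nat.Base using (_!)
open import Data.Integer as ℤ using (ℤ; +_; -[1+_])
open import Data.Fin using (Fin; toℕ)
open import Data.Vec using (Vec; []; _∷_; _∷ʳ_; last; lookup)
open import Data.List using (List; []; _∷_; map; concatMap; foldr; upTo)
open import Relation.Nullary using (¬_)

-- A field of characteristic zero (generalising ℂ), presented as a commutative
-- ring together with a (total) inverse function that is a genuine inverse on
-- nonzero elements.
-- canonical image of ℕ in a commutative ring
ringFromℕ : ∀ {c ℓ} (R : CommutativeRing c ℓ) → ℕ → CommutativeRing.Carrier R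
ringFromℕ R zero    = CommutativeRing.0# R
ringFromℕ R (suc n) = CommutativeRing._+_ R (CommutativeRing.1# R) (ringFromℕ R n)

record CharZeroField (c ℓ : Level) : Set (lsuc (c ⊔ ℓ)) where
  field
    cring : CommutativeRing c ℓ
  open CommutativeRing cring public

  fromℕ : ℕ → Carrier
  fromℕ = ringFromℕ cring

  field
    _⁻¹      : Carrier → Carrier
    ⁻¹-cong  : ∀ {x y} → x ≈ y → x ⁻¹ ≈ y ⁻¹
    inverseʳ : ∀ x → ¬ (x ≈ 0#) → x * (x ⁻¹) ≈ 1#
    charZero : ∀ n → ¬ (fromℕ (suc n) ≈ 0#)

module _ {c ℓ} (F : CharZeroField c ℓ) where
  open CharZeroField F

  fromℤ : ℤ → Carrier
  fromℤ (+ n)     = fromℕ n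
  fromℤ -[1+ n ]  = - fromℕ (suc n)

  pow : Carrier → ℕ → Carrier
  pow y zero    = 1#
  pow y (suc n) = y * pow y n

  zpow : Carrier → ℤ → Carrier
  zpow y (+ n)    = pow y n
  zpow y -[1+ n ] = pow (y ⁻¹) (suc n)

  sumL : List Carrier → Carrier
  sumL = foldr _+_ 0#

  sumTo : ℕ → (ℕ → Carrier) → Carrier
  sumTo n f = sumL (map f (upTo (suc n)))

  -- Formal power series in t, represented by their exponential
  -- coefficients: f ↔ Σ_n f n t^n/n!.
  EGF : Set c
  EGF = ℕ → Carrier

  _⊛_ : EGF → EGF → EGF
  (f ⊛ g) n = sumTo n (λ i → fromℕ (n C i) * (f i * g (n ∸ i)))

  oneE : EGF
  oneE zero    = 1#
  oneE (suc n) = 0#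

  _-E_ : EGF → EGF → EGF
  (f -E g) n = f n - g n

  powE : EGF → ℕ → EGF
  powE f zero    = oneE
  powE f (suc m) = f ⊛ powE f m

  expE : Carrier → EGF
  expE y n = pow y n

  chains : (l b : ℕ) → List (Vec ℕ l)
  chains zero    b = [] ∷ []
  chains (suc l) b = concatMap (λ m → map (λ v → v ∷ʳ m) (chains l m)) (upTo (suc b))

  -- (m₁+a-r+1)^{k₁} (m₂+a-r+2)^{k₂} ⋯ (m_r+a)^{k_r}
  denom : ∀ {r} → Vec ℤ r → Carrier → Vec ℕ r → Carrier
  denom {r} ks a ms = prod (upToFin r)
    where
      upToFin : (n : ℕ) → List (Fin r)
      upToFin _ = Data.List.allFin r
        where import Data.List
      prod : List (Fin r) → Carrier
      prod = foldr (λ i acc →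
        zpow (fromℕ (lookup ms i) + a - fromℕ (r ∸ suc (toℕ i))) (lookup ks i) * acc) 1#

  -- coefficient of z^M in Φ_{(k₁,…,k_r)}(z,a), r = suc r'
  Φcoeff : ∀ {r'} → Vec ℤ (suc r') → Carrier → ℕ → Carrier
  Φcoeff {r'} ks a M = sumL (map (λ w → (denom ks a (w ∷ʳ M)) ⁻¹) (chains r' M))

  -- exponential coefficients of the composite Φ(1 - e^{-t}, a).  Since
  -- (1 - e^{-t})^m has no terms of degree < m, only m ≤ n contribute to t^n.
  ΦcompE : ∀ {r'} → Vec ℤ (suc r') → Carrier → EGF
  ΦcompE ks a n = sumTo n (λ m → Φcoeff ks a m * powE (oneE -E expE (- 1#)) m n)

  B : ∀ {r'} → Vec ℤ (suc r') → Carrier → Carrier → ℕ → Carrier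
  B {r'} ks a x = ΦcompE ks a ⊛ expE (fromℕ (suc r') * x)

  stirling : (β ρ : Carrier) → (n m : ℕ) → Carrier
  stirling β ρ n m =
    ((pow β m * fromℕ (m !)) ⁻¹) * ((expE ρ ⊛ powE (expE β -E oneE) m) n)

module Submission where

-- Let v = 1 - e^{-t} and c_m the coefficient of z^m in Φ_{(k)}(z,a), so that
-- Σ_n B_n t^n/n! = (Σ_m c_m v^m) e^{rxt}.  As v has no constant term, v^m
-- has order ≥ m; hence only m ≤ n contribute to t^n and, by linearity,
--     B_n = Σ_{m ≤ n} c_m [t^n/n!] (v^m e^{rxt}).
-- Since (e^{-t} - 1)^m = (-1)^m v^m, the definition of the Stirling numbers
-- gives m! {n m}_{-1,xr} = [t^n/n!] (e^{xrt} v^m).  Finally c_m is a sum over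
-- chains m_1 ≤ … ≤ m_{r-1} ≤ m, and regrouping yields the sum over chains
-- of length r ending at most at n.  The
-- hypothesis on a only keeps denominators nonzero; as the inverse is total
-- here, the identity holds without it.

open import Defs
open import Data.Nat using (ℕ; suc)
open import Data.Nat.Base using (_!)
open import Data.Integer using (ℤ; +_) renaming (_≤_ to _≤ℤ_)
open import Data.Vec using (Vec; last)
open import Data.List using (map)
open import Relation.Nullary using (¬_)

import Data.Nat as ℕ
open import Data.Nat using (zero; _∸_; _≤_; _<_; s≤s; _<?_)
open import Data.Nat.Properties using (_!≢0; m≤n+m; ≤-trans; ≤-<-trans; ∸-monoʳ-≤; ≮⇒≥; m∸n+n≡m; m∸[m∸n]≡n)
open import Data.Nat.Combinatorics using (_C_; nCk≡nC[n∸k])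
open import Data.Fin using (Fin; toℕ)
open import Data.Fin.Properties using (toℕ<n; toℕ-inject₁; toℕ-fromℕ; opposite-prop)
import Data.Fin.Permutation as Perm
open import Data.Vec using (_∷ʳ_)
open import Data.Vec.Properties using (last-∷ʳ)
open import Data.List using (List; []; _∷_; _++_; applyUpTo; upTo; concatMap)
open import Data.List.Properties using (map-applyUpTo; map-∘; map-cong)
open import Function using (id; _∘_)
open import Relation.Nullary using (yes; no)
open import Relation.Binary.PropositionalEquality as ≡ using (_≡_)
import Relation.Binary.Reasoning.Setoid as SetoidReasoning
import Algebra.Properties.Ring as RingProperties
import Algebra.Properties.AbelianGroup as AbelianGroupProperties
import Algebra.Properties.CommutativeSemigroup as CommutativeSemigroupProperties
import Algebra.Properties.Semiring.Sum as SemiringSum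

module Development {c ℓ} (F : CharZeroField c ℓ) where
  open CharZeroField F
  open SetoidReasoning setoid
  open SemiringSum semiring
    using (sum; ∑-comm; *-distribˡ-sum; *-distribʳ-sum; sum-cong-≋; sum-cong-≗;
           sum-replicate-zero; sum-init-last; sum-permute)
  open CommutativeSemigroupProperties *-commutativeSemigroup
    using (x∙yz≈y∙xz; interchange)
  private
    module Ring = RingProperties ring
    module AbelianGroup = AbelianGroupProperties +-abelianGroup

  -- the vector (f 0, …, f (k-1)), so that the library's Fin-indexed sums apply
  below : ∀ k → (ℕ → Carrier) → Fin k → Carrier
  below k f i = f (toℕ i)

  ∑ : ℕ → (ℕ → Carrier) → Carrier
  ∑ k f = sum (below k f)

  sumL-applyUpTo : ∀ k f → sumL F (applyUpTo f k) ≡ ∑ k f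
  sumL-applyUpTo zero    f = ≡.refl
  sumL-applyUpTo (suc k) f = ≡.cong (λ s → f 0 + s) (sumL-applyUpTo k (f ∘ suc))

  sumL-upTo : ∀ k f → sumL F (map f (upTo k)) ≡ ∑ k f
  sumL-upTo k f = ≡.trans (≡.cong (sumL F) (map-applyUpTo id f k)) (sumL-applyUpTo k f)

  ∑-cong : ∀ k {f g} → (∀ i → i < k → f i ≈ g i) → ∑ k f ≈ ∑ k g
  ∑-cong k f≈g = sum-cong-≋ (λ i → f≈g (toℕ i) (toℕ<n i))

  ∑-zero : ∀ k {f} → (∀ i → i < k → f i ≈ 0#) → ∑ k f ≈ 0#
  ∑-zero k f≈0 = trans (∑-cong k f≈0) (sum-replicate-zero k)

  ∑-*ˡ : ∀ k y f → y * ∑ k f ≈ ∑ k (λ i → y * f i)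
  ∑-*ˡ k y f = *-distribˡ-sum y (below k f)

  ∑-*ʳ : ∀ k y f → ∑ k f * y ≈ ∑ k (λ i → f i * y)
  ∑-*ʳ k y f = *-distribʳ-sum y (below k f)

  ∑-swap : ∀ k l (f : ℕ → ℕ → Carrier) → ∑ k (λ i → ∑ l (f i)) ≈ ∑ l (λ j → ∑ k (λ i → f i j))
  ∑-swap k l f = ∑-comm {k} {l} (λ i j → f (toℕ i) (toℕ j))

  ∑-snoc : ∀ k f → ∑ (suc k) f ≈ ∑ k f + f k
  ∑-snoc k f = trans (sum-init-last (below (suc k) f))
    (+-cong (reflexive (sum-cong-≗ {k} (λ i → ≡.cong f (toℕ-inject₁ i))))
            (reflexive (≡.cong f (toℕ-fromℕ k))))

  ∑-reverse : ∀ k f → ∑ k f ≈ ∑ k (λ i → f (k ∸ suc i))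
  ∑-reverse k f = trans (sum-permute (below k f) Perm.reverse)
    (reflexive (sum-cong-≗ {k} (λ i → ≡.cong f (opposite-prop i))))

  ∑-vanishing-tail : ∀ k d f → (∀ j → k ≤ j → f j ≈ 0#) → ∑ (d ℕ.+ k) f ≈ ∑ k f
  ∑-vanishing-tail k zero    f tail≈0 = refl
  ∑-vanishing-tail k (suc d) f tail≈0 = begin
    ∑ (suc (d ℕ.+ k)) f          ≈⟨ ∑-snoc (d ℕ.+ k) f ⟩
    ∑ (d ℕ.+ k) f + f (d ℕ.+ k)  ≈⟨ +-cong (∑-vanishing-tail k d f tail≈0) (tail≈0 _ (m≤n+m k d)) ⟩
    ∑ k f + 0#                   ≈⟨ +-identityʳ _ ⟩
    ∑ k f                        ∎

  sumL-++ : ∀ {A : Set} (g : A → Carrier) xs ys →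
            sumL F (map g (xs ++ ys)) ≈ sumL F (map g xs) + sumL F (map g ys)
  sumL-++ g []       ys = sym (+-identityˡ _)
  sumL-++ g (x ∷ xs) ys = trans (+-congˡ (sumL-++ g xs ys)) (sym (+-assoc _ _ _))

  sumL-concatMap : ∀ {A B : Set} (g : B → Carrier) (h : A → List B) xs →
                   sumL F (map g (concatMap h xs)) ≈ sumL F (map (λ x → sumL F (map g (h x))) xs)
  sumL-concatMap g h []       = refl
  sumL-concatMap g h (x ∷ xs) = trans (sumL-++ g (h x) (concatMap h xs)) (+-congˡ (sumL-concatMap g h xs))

  sumL-*ˡ : ∀ {A : Set} y (g : A → Carrier) xs → y * sumL F (map g xs) ≈ sumL F (map (λ x → y * g x) xs)
  sumL-*ˡ y g []       = zeroʳ y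
  sumL-*ˡ y g (x ∷ xs) = trans (distribˡ y _ _) (+-congˡ (sumL-*ˡ y g xs))

  infixl 7 _⋆_
  _⋆_ : EGF F → EGF F → EGF F
  _⋆_ = _⊛_ F

  convTerm : EGF F → EGF F → ℕ → ℕ → Carrier
  convTerm f g n i = fromℕ (n C i) * (f i * g (n ∸ i))

  ⋆-unfold : ∀ f g n → (f ⋆ g) n ≈ ∑ (suc n) (convTerm f g n)
  ⋆-unfold f g n = reflexive (sumL-upTo (suc n) (convTerm f g n))

  -- Commutativity: reverse the convolution sum, using C(n,i) = C(n,n-i).
  ⋆-comm : ∀ f g n → (f ⋆ g) n ≈ (g ⋆ f) n
  ⋆-comm f g n = begin
    (f ⋆ g) n                                 ≈⟨ ⋆-unfold f g n ⟩
    ∑ (suc n) (convTerm f g n)                ≈⟨ ∑-reverse (suc n) (convTerm f g n) ⟩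
    ∑ (suc n) (λ i → convTerm f g n (n ∸ i))  ≈⟨ ∑-cong (suc n) reflected ⟩
    ∑ (suc n) (convTerm g f n)                ≈⟨ ⋆-unfold g f n ⟨
    (g ⋆ f) n                                 ∎
    where
      reflected : ∀ i → i < suc n → convTerm f g n (n ∸ i) ≈ convTerm g f n i
      reflected i (s≤s i≤n) = trans
        (reflexive (≡.cong₂ (λ p q → fromℕ p * (f (n ∸ i) * g q))
                            (≡.sym (nCk≡nC[n∸k] i≤n)) (m∸[m∸n]≡n i≤n)))
        (*-congˡ (*-comm _ _))

  ⋆-congˡ : ∀ f f' g n → (∀ i → i ≤ n → f i ≈ f' i) → (f ⋆ g) n ≈ (f' ⋆ g) n
  ⋆-congˡ f f' g n f≈f' = begin
    (f ⋆ g) n                   ≈⟨ ⋆-unfold f g n ⟩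
    ∑ (suc n) (convTerm f g n)  ≈⟨ ∑-cong (suc n) {convTerm f g n} (λ { i (s≤s i≤n) → *-congˡ (*-congʳ (f≈f' i i≤n)) }) ⟩
    ∑ (suc n) (convTerm f' g n) ≈⟨ ⋆-unfold f' g n ⟨
    (f' ⋆ g) n                  ∎

  ⋆-scale : ∀ f f' g g' y z n → (∀ i → f i ≈ y * f' i) → (∀ i → g i ≈ z * g' i) →
            (f ⋆ g) n ≈ (y * z) * (f' ⋆ g') n
  ⋆-scale f f' g g' y z n f≈yf' g≈zg' = begin
    (f ⋆ g) n                                        ≈⟨ ⋆-unfold f g n ⟩
    ∑ (suc n) (convTerm f g n)                       ≈⟨ ∑-cong (suc n) (λ i _ → scaled i) ⟩
    ∑ (suc n) (λ i → (y * z) * convTerm f' g' n i)   ≈⟨ ∑-*ˡ (suc n) (y * z) (convTerm f' g' n) ⟨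
    (y * z) * ∑ (suc n) (convTerm f' g' n)           ≈⟨ *-congˡ (⋆-unfold f' g' n) ⟨
    (y * z) * (f' ⋆ g') n                            ∎
    where
      scaled : ∀ i → convTerm f g n i ≈ (y * z) * convTerm f' g' n i
      scaled i = trans (*-congˡ (trans (*-cong (f≈yf' i) (g≈zg' (n ∸ i))) (interchange y (f' i) z (g' (n ∸ i)))))
                       (x∙yz≈y∙xz _ _ _)

  ⋆-linearˡ : ∀ N (c : ℕ → Carrier) (P : ℕ → EGF F) g n →
              ((λ i → ∑ N (λ m → c m * P m i)) ⋆ g) n ≈ ∑ N (λ m → c m * (P m ⋆ g) n)
  ⋆-linearˡ N c P g n = begin
    ((λ i → ∑ N (λ m → c m * P m i)) ⋆ g) n
      ≈⟨ ⋆-unfold _ g n ⟩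
    ∑ (suc n) (λ i → fromℕ (n C i) * (∑ N (λ m → c m * P m i) * g (n ∸ i)))
      ≈⟨ ∑-cong (suc n) (λ i _ → distribute i) ⟩
    ∑ (suc n) (λ i → ∑ N (λ m → c m * convTerm (P m) g n i))
      ≈⟨ ∑-swap (suc n) N (λ i m → c m * convTerm (P m) g n i) ⟩
    ∑ N (λ m → ∑ (suc n) (λ i → c m * convTerm (P m) g n i))
      ≈⟨ ∑-cong N (λ m _ → trans (sym (∑-*ˡ (suc n) (c m) (convTerm (P m) g n)))
                                 (*-congˡ (sym (⋆-unfold (P m) g n)))) ⟩
    ∑ N (λ m → c m * (P m ⋆ g) n) ∎
    where
      distribute : ∀ i → fromℕ (n C i) * (∑ N (λ m → c m * P m i) * g (n ∸ i))
                         ≈ ∑ N (λ m → c m * convTerm (P m) g n i)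
      distribute i = begin
        fromℕ (n C i) * (∑ N (λ m → c m * P m i) * g (n ∸ i))
          ≈⟨ *-congˡ (∑-*ʳ N (g (n ∸ i)) (λ m → c m * P m i)) ⟩
        fromℕ (n C i) * ∑ N (λ m → (c m * P m i) * g (n ∸ i))
          ≈⟨ ∑-*ˡ N (fromℕ (n C i)) (λ m → (c m * P m i) * g (n ∸ i)) ⟩
        ∑ N (λ m → fromℕ (n C i) * ((c m * P m i) * g (n ∸ i)))
          ≈⟨ ∑-cong N (λ m _ → trans (*-congˡ (*-assoc (c m) (P m i) _)) (x∙yz≈y∙xz (fromℕ (n C i)) (c m) _)) ⟩
        ∑ N (λ m → c m * convTerm (P m) g n i) ∎

  HasOrder : EGF F → ℕ → Set ℓ
  HasOrder f p = ∀ i → i < p → f i ≈ 0#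

  ∸-<-bound : ∀ p {i q} → p ≤ i → i < p ℕ.+ q → i ∸ p < q
  ∸-<-bound zero    _         i<q       = i<q
  ∸-<-bound (suc p) (s≤s p≤i) (s≤s i<q) = ∸-<-bound p p≤i i<q

  -- Orders add under multiplication: in every term f_j g_{i-j} of the
  -- coefficient of t^i with i < p + q, either j < p or i - j < q.
  ⋆-order : ∀ {f g} p q → HasOrder f p → HasOrder g q → HasOrder (f ⋆ g) (p ℕ.+ q)
  ⋆-order {f} {g} p q f-order g-order i i<p+q =
    trans (⋆-unfold f g i) (∑-zero (suc i) vanishing)
    where
      vanishing : ∀ j → j < suc i → convTerm f g i j ≈ 0#
      vanishing j (s≤s j≤i) with j <? p
      ... | yes j<p = trans (*-congˡ (trans (*-congʳ (f-order j j<p)) (zeroˡ _))) (zeroʳ _)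
      ... | no  j≮p = trans (*-congˡ (trans (*-congˡ (g-order (i ∸ j) i∸j<q)) (zeroʳ _))) (zeroʳ _)
        where
          p≤j : p ≤ j
          p≤j = ≮⇒≥ j≮p
          i∸j<q : i ∸ j < q
          i∸j<q = ≤-<-trans (∸-monoʳ-≤ i p≤j) (∸-<-bound p (≤-trans p≤j j≤i) i<p+q)

  powE-order : ∀ {f} → HasOrder f 1 → ∀ m → HasOrder (powE F f m) m
  powE-order f-order zero    i ()
  powE-order f-order (suc m) = ⋆-order 1 m f-order (powE-order f-order m)

  v : EGF F
  v = _-E_ F (oneE F) (expE F (- 1#))

  vPow : ℕ → EGF F
  vPow = powE F v

  v-order : HasOrder v 1
  v-order zero    _ = -‿inverseʳ 1#
  v-order (suc i) (s≤s ())

  vPow-order : ∀ m → HasOrder (vPow m) m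
  vPow-order = powE-order v-order

  sign : ℕ → Carrier
  sign = pow F (- 1#)

  sign-square : ∀ m → sign m * sign m ≈ 1#
  sign-square zero    = *-identityˡ 1#
  sign-square (suc m) = begin
    (- 1# * sign m) * (- 1# * sign m)  ≈⟨ interchange (- 1#) (sign m) (- 1#) (sign m) ⟩
    (- 1# * - 1#) * (sign m * sign m)  ≈⟨ *-cong (trans (Ring.-1*x≈-x (- 1#)) (AbelianGroup.⁻¹-involutive 1#)) (sign-square m) ⟩
    1# * 1#                            ≈⟨ *-identityˡ 1# ⟩
    1#                                 ∎

  negated-vPow : ∀ m i → powE F (_-E_ F (expE F (- 1#)) (oneE F)) m i ≈ sign m * vPow m i
  negated-vPow zero    i = sym (*-identityˡ _)
  negated-vPow (suc m) i = ⋆-scale _ v _ (vPow m) (- 1#) (sign m) i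
    (λ j → sym (trans (Ring.-1*x≈-x (v j)) (AbelianGroup.⁻¹-anti-homo‿- (oneE F j) (sign j))))
    (negated-vPow m)

  fromℕ-nonzero : ∀ n → {{ℕ.NonZero n}} → ¬ (fromℕ n ≈ 0#)
  fromℕ-nonzero (suc n) = charZero n

  -- a sign times a nonzero element is nonzero; with the previous lemma this
  -- makes the normalising factor (-1)^m m! of the Stirling numbers invertible
  sign-*-nonzero : ∀ m {w} → ¬ (w ≈ 0#) → ¬ (sign m * w ≈ 0#)
  sign-*-nonzero m {w} w≉0 sw≈0 = w≉0 (begin
    w                    ≈⟨ *-identityˡ w ⟨
    1# * w               ≈⟨ *-congʳ (sign-square m) ⟨
    (sign m * sign m) * w ≈⟨ *-assoc _ _ _ ⟩
    sign m * (sign m * w) ≈⟨ *-congˡ sw≈0 ⟩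
    sign m * 0#          ≈⟨ zeroʳ _ ⟩
    0#                   ∎)

  cancel-inverse : ∀ s w Q → ¬ (s * w ≈ 0#) → w * ((s * w) ⁻¹ * (s * Q)) ≈ Q
  cancel-inverse s w Q sw≉0 = begin
    w * (d ⁻¹ * (s * Q))  ≈⟨ x∙yz≈y∙xz w (d ⁻¹) (s * Q) ⟩
    d ⁻¹ * (w * (s * Q))  ≈⟨ *-congˡ (trans (x∙yz≈y∙xz w s Q) (sym (*-assoc s w Q))) ⟩
    d ⁻¹ * (d * Q)        ≈⟨ *-assoc _ _ _ ⟨
    (d ⁻¹ * d) * Q        ≈⟨ *-congʳ (trans (*-comm _ _) (inverseʳ d sw≉0)) ⟩
    1# * Q                ≈⟨ *-identityˡ Q ⟩
    Q                     ∎
    where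
      d : Carrier
      d = s * w

  -- m! {n m}_{-1,ρ} = [t^n/n!] e^{ρt} (1 - e^{-t})^m: the sign (-1)^m of
  -- (e^{-t} - 1)^m cancels against the normalising factor
  stirling-as-product : ∀ ρ n m → fromℕ (m !) * stirling F (- 1#) ρ n m ≈ (expE F ρ ⋆ vPow m) n
  stirling-as-product ρ n m = begin
    fromℕ (m !) * ((sign m * fromℕ (m !)) ⁻¹ * (expE F ρ ⋆ powE F u m) n)
      ≈⟨ *-congˡ (*-congˡ (⋆-scale (expE F ρ) (expE F ρ) (powE F u m) (vPow m) 1# (sign m) n
                             (λ i → sym (*-identityˡ _)) (negated-vPow m))) ⟩
    fromℕ (m !) * ((sign m * fromℕ (m !)) ⁻¹ * ((1# * sign m) * (expE F ρ ⋆ vPow m) n))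
      ≈⟨ *-congˡ (*-congˡ (*-congʳ (*-identityˡ _))) ⟩
    fromℕ (m !) * ((sign m * fromℕ (m !)) ⁻¹ * (sign m * (expE F ρ ⋆ vPow m) n))
      ≈⟨ cancel-inverse (sign m) (fromℕ (m !)) _ (sign-*-nonzero m (fromℕ-nonzero (m !) {{m !≢0}})) ⟩
    (expE F ρ ⋆ vPow m) n ∎
    where
      u : EGF F
      u = _-E_ F (expE F (- 1#)) (oneE F)

  -- Σ_m c_m v^m, computed coefficientwise with the finitely many m that
  -- can contribute (this is the shape of ΦcompE)
  composeWith : (ℕ → Carrier) → EGF F
  composeWith c i = sumTo F i (λ m → c m * vPow m i)

  compose-truncate : ∀ c {i n} → i ≤ n → composeWith c i ≈ ∑ (suc n) (λ m → c m * vPow m i)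
  compose-truncate c {i} {n} i≤n = begin
    composeWith c i                           ≡⟨ sumL-upTo (suc i) _ ⟩
    ∑ (suc i) (λ m → c m * vPow m i)          ≈⟨ ∑-vanishing-tail (suc i) (n ∸ i) _ beyond-i ⟨
    ∑ (n ∸ i ℕ.+ suc i) (λ m → c m * vPow m i) ≡⟨ ≡.cong (λ k → ∑ k (λ m → c m * vPow m i)) (m∸n+n≡m (s≤s i≤n)) ⟩
    ∑ (suc n) (λ m → c m * vPow m i)          ∎
    where
      beyond-i : ∀ m → suc i ≤ m → c m * vPow m i ≈ 0#
      beyond-i m i<m = trans (*-congˡ (vPow-order m i i<m)) (zeroʳ _)

  compose-⋆ : ∀ c g n → (composeWith c ⋆ g) n ≈ ∑ (suc n) (λ m → c m * (vPow m ⋆ g) n)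
  compose-⋆ c g n = trans (⋆-congˡ (composeWith c) _ g n (λ i → compose-truncate c))
                          (⋆-linearˡ (suc n) c vPow g n)

  chain-sum : ∀ {r'} (ks : Vec ℤ (suc r')) a (K : ℕ → Carrier) n →
    ∑ (suc n) (λ m → Φcoeff F ks a m * K m)
      ≈ sumL F (map (λ ms → K (last ms) * denom F ks a ms ⁻¹) (chains F (suc r') n))
  chain-sum {r'} ks a K n = begin
    ∑ (suc n) (λ m → Φcoeff F ks a m * K m)
      ≈⟨ ∑-cong (suc n) (λ m _ → trans (*-comm _ _) (chains-ending-at m)) ⟩
    ∑ (suc n) (λ m → sumL F (map G (extend m)))
      ≡⟨ sumL-upTo (suc n) _ ⟨
    sumL F (map (λ m → sumL F (map G (extend m))) (upTo (suc n)))
      ≈⟨ sumL-concatMap G extend (upTo (suc n)) ⟨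
    sumL F (map G (chains F (suc r') n)) ∎
    where
      G : Vec ℕ (suc r') → Carrier
      G ms = K (last ms) * denom F ks a ms ⁻¹
      extend : ℕ → List (Vec ℕ (suc r'))
      extend m = map (_∷ʳ m) (chains F r' m)
      chains-ending-at : ∀ m → K m * Φcoeff F ks a m ≈ sumL F (map G (extend m))
      chains-ending-at m = begin
        K m * Φcoeff F ks a m
          ≈⟨ sumL-*ˡ (K m) _ (chains F r' m) ⟩
        sumL F (map (λ w → K m * denom F ks a (w ∷ʳ m) ⁻¹) (chains F r' m))
          ≡⟨ ≡.cong (sumL F) (map-cong (λ w → ≡.cong (λ l → K l * denom F ks a (w ∷ʳ m) ⁻¹)
                                                     (≡.sym (last-∷ʳ m w))) (chains F r' m)) ⟩
        sumL F (map (G ∘ (_∷ʳ m)) (chains F r' m))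
          ≡⟨ ≡.cong (sumL F) (map-∘ (chains F r' m)) ⟩
        sumL F (map G (extend m)) ∎

  -- e^{yt} only depends on y up to ≈ (the theorem writes rx as x·r)
  pow-cong : ∀ k {y y'} → y ≈ y' → pow F y k ≈ pow F y' k
  pow-cong zero    y≈y' = refl
  pow-cong (suc k) y≈y' = *-cong y≈y' (pow-cong k y≈y')

  explicit-formula : ∀ r' (ks : Vec ℤ (suc r')) a x n →
    B F ks a x n ≈
      sumL F (map (λ ms → (fromℕ (last ms !) * stirling F (- 1#) (x * fromℕ (suc r')) n (last ms))
                          * denom F ks a ms ⁻¹)
                  (chains F (suc r') n))
  explicit-formula r' ks a x n = begin
    (composeWith Φ ⋆ expE F (fromℕ (suc r') * x)) n
      ≈⟨ compose-⋆ Φ (expE F (fromℕ (suc r') * x)) n ⟩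
    ∑ (suc n) (λ m → Φ m * (vPow m ⋆ expE F (fromℕ (suc r') * x)) n)
      ≈⟨ ∑-cong (suc n) (λ m _ → *-congˡ {Φ m} (stirling-term m)) ⟩
    ∑ (suc n) (λ m → Φ m * (fromℕ (m !) * stirling F (- 1#) ρ n m))
      ≈⟨ chain-sum ks a (λ m → fromℕ (m !) * stirling F (- 1#) ρ n m) n ⟩
    _ ∎
    where
      Φ : ℕ → Carrier
      Φ = Φcoeff F ks a
      ρ : Carrier
      ρ = x * fromℕ (suc r')
      stirling-term : ∀ m → (vPow m ⋆ expE F (fromℕ (suc r') * x)) n ≈ fromℕ (m !) * stirling F (- 1#) ρ n m
      stirling-term m = begin
        (vPow m ⋆ expE F (fromℕ (suc r') * x)) n ≈⟨ ⋆-comm (vPow m) _ n ⟩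
        (expE F (fromℕ (suc r') * x) ⋆ vPow m) n ≈⟨ ⋆-congˡ _ (expE F ρ) (vPow m) n (λ i _ → pow-cong i (*-comm _ _)) ⟩
        (expE F ρ ⋆ vPow m) n                    ≈⟨ stirling-as-product ρ n m ⟨
        fromℕ (m !) * stirling F (- 1#) ρ n m    ∎

theorem5p1 : ∀ {c ℓ} (F : CharZeroField c ℓ) (r' : ℕ) (ks : Vec ℤ (suc r'))
    (a x : CharZeroField.Carrier F) →
    (∀ (z : ℤ) → z ≤ℤ + r' → ¬ CharZeroField._≈_ F a (fromℤ F z)) →
    ∀ (n : ℕ) →
    CharZeroField._≈_ F (B F ks a x n)
      (sumL F (map (λ ms → CharZeroField._*_ F
                     (CharZeroField._*_ F (CharZeroField.fromℕ F (last ms !))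
                       (stirling F (CharZeroField.-_ F (CharZeroField.1# F))
                         (CharZeroField._*_ F x (CharZeroField.fromℕ F (suc r'))) n (last ms)))
                     (CharZeroField._⁻¹ F (denom F ks a ms)))
                   (chains F (suc r') n)))
theorem5p1 F r' ks a x _ n = Development.explicit-formula F r' ks a x n
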